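{- Let $\mathbb{Q}=(\Omega,\leq,\otimes,\mathsf{k})$ be a Lawverian quantale and $R,S\colon A\times A\to\Omega$ be $\mathbb{Q}$-relations on a set $A$. If $R^{*}$ commutes with $S^{*}$ and both $R$ and $S$ are confluent, then $R\vee S$ is confluent.
   Context: A quantale is a complete lattice $(\Omega,\leq)$ with a monoid $(\Omega,\otimes,\mathsf{k})$ whose multiplication distributes over arbitrary joins in each argument; Lawverian means commutative, integral ($\mathsf{k}$ is top), cointegral ($\varepsilon\otimes\delta=\bot$ implies $\varepsilon=\bot$ or $\delta=\bot$), non-trivial. $\mathbb{Q}$-relations are maps $A\times A\to\Omega$ ordered and joined pointwise; $(R;S)(a,c)=\bigvee_b R(a,b)\otimes S(b,c)$; $\Delta(a,a)=\mathsf{k}$, $\Delta(a,b)=\bot$ for $a\neq b$; $R^{ - }(b,a)=R(a,b)$; $R^0=\Delta$, $R^{n+1}=R;R^n$, $R^{*}=\bigvee_{n\geq0}R^n$. $R$ commutes with $S$ if $R^{ - };S\leq S;R^{ - }$. $R$ has the diamond property if $R$ commutes with itself. $R$ is confluent if $R^{*}$ has the diamond property. -}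

module Defs where

open import Data.Nat using (ℕ; zero; suc)
open import Data.Bool using (Bool; true; false; if_then_else_)
open import Data.Empty using (⊥-elim) renaming (⊥ to Empty)
open import Data.Sum using (_⊎_)
open import Relation.Binary.PropositionalEquality using (_≡_)
open import Relation.Binary.Structures using (IsPartialOrder)
open import Relation.Nullary using (¬_)

record Quantale : Set₁ where
  infixr 7 _⊗_
  infix 4 _≤_
  field
    Ω              : Set
    _≤_            : Ω → Ω → Set
    isPartialOrder : IsPartialOrder _≡_ _≤_
    ⋁              : {I : Set} → (I → Ω) → Ω
    ⋁-upper        : {I : Set} (f : I → Ω) (i : I) → f i ≤ ⋁ f
    ⋁-least        : {I : Set} (f : I → Ω) (x : Ω) → (∀ i → f i ≤ x) → ⋁ f ≤ x
    _⊗_            : Ω → Ω → Ω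
    k              : Ω
    ⊗-assoc        : ∀ x y z → (x ⊗ y) ⊗ z ≡ x ⊗ (y ⊗ z)
    ⊗-identityˡ    : ∀ x → k ⊗ x ≡ x
    ⊗-identityʳ    : ∀ x → x ⊗ k ≡ x
    ⊗-distribˡ-⋁   : {I : Set} (x : Ω) (f : I → Ω) → x ⊗ ⋁ f ≡ ⋁ (λ i → x ⊗ f i)
    ⊗-distribʳ-⋁   : {I : Set} (f : I → Ω) (x : Ω) → ⋁ f ⊗ x ≡ ⋁ (λ i → f i ⊗ x)

  bot : Ω
  bot = ⋁ {Empty} ⊥-elim

record LawverianQuantale : Set₁ where
  field
    quantale   : Quantale
  open Quantale quantale public
  field
    ⊗-comm     : ∀ x y → x ⊗ y ≡ y ⊗ x
    integral   : ∀ x → x ≤ k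
    cointegral : ∀ ε δ → ε ⊗ δ ≡ bot → (ε ≡ bot) ⊎ (δ ≡ bot)
    nontrivial : ¬ (k ≡ bot)

module _ (Q : Quantale) where
  open Quantale Q

  QRel : Set → Set
  QRel A = A → A → Ω

  _⊑_ : {A : Set} → QRel A → QRel A → Set
  R ⊑ S = ∀ a b → R a b ≤ S a b

  _∨ʳ_ : {A : Set} → QRel A → QRel A → QRel A
  (R ∨ʳ S) a b = ⋁ {Bool} (λ t → if t then R a b else S a b)

  _⨾_ : {A : Set} → QRel A → QRel A → QRel A
  (R ⨾ S) a c = ⋁ {_} (λ b → R a b ⊗ S b c)

  -- identity relation: Δ(a,b) = k if a = b, ⊥ otherwise
  -- (written as the join of k over proofs of a ≡ b)
  Δ : {A : Set} → QRel A
  Δ a b = ⋁ {a ≡ b} (λ _ → k)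

  _⁻ : {A : Set} → QRel A → QRel A
  (R ⁻) b a = R a b

  _^_ : {A : Set} → QRel A → ℕ → QRel A
  R ^ zero  = Δ
  R ^ suc n = R ⨾ (R ^ n)

  _* : {A : Set} → QRel A → QRel A
  (R *) a b = ⋁ {ℕ} (λ n → (R ^ n) a b)

  Commutes : {A : Set} → QRel A → QRel A → Set
  Commutes R S = ((R ⁻) ⨾ S) ⊑ (S ⨾ (R ⁻))

  Diamond : {A : Set} → QRel A → Set
  Diamond R = Commutes R R

  Confluent : {A : Set} → QRel A → Set
  Confluent R = Diamond (R *)

-- Put U = R* ; S*.  Because R* commutes with S* and both have the diamond
-- property, U has the diamond property (push converses past U one factor at a
-- time).  The diamond property of a relation passes to its reflexive-transitive
-- closure, so U* has it too; and U* = (R ∨ S)*, since R ∨ S ⊑ U ⊑ (R ∨ S)*.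
module Submission where

open import Data.Bool using (Bool; true; false; if_then_else_)
open import Data.Nat using (ℕ; zero; suc)
open import Relation.Binary.Bundles using (Poset; Preorder)
open import Relation.Binary.PropositionalEquality using (_≡_; refl; sym; trans; cong)
open import Relation.Binary.Structures using (IsPartialOrder)
import Relation.Binary.Reasoning.PartialOrder as PosetReasoning
import Relation.Binary.Reasoning.Preorder as PreorderReasoning
import Defs
open Defs using (Quantale; LawverianQuantale; QRel)

module QuantaleProperties (Q : Quantale) where
  open Quantale Q
  open IsPartialOrder isPartialOrder public
    using (antisym) renaming (refl to ≤-refl; reflexive to ≤-reflexive; trans to ≤-trans)

  poset : Poset _ _ _
  poset = record { isPartialOrder = isPartialOrder }

  module ≤-Reasoning = PosetReasoning poset

  infixr 6 _∨_
  _∨_ : Ω → Ω → Ω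
  x ∨ y = ⋁ {Bool} (λ t → if t then x else y)

  x≤y⇒x∨y≡y : ∀ {x y} → x ≤ y → x ∨ y ≡ y
  x≤y⇒x∨y≡y {x} {y} x≤y = antisym (⋁-least _ y λ { true → x≤y ; false → ≤-refl }) (⋁-upper _ false)

  ⋁-mono : ∀ {I : Set} {f g : I → Ω} → (∀ i → f i ≤ g i) → ⋁ f ≤ ⋁ g
  ⋁-mono {g = g} f≤g = ⋁-least _ _ λ i → ≤-trans (f≤g i) (⋁-upper g i)

  ⋁-cong : ∀ {I : Set} {f g : I → Ω} → (∀ i → f i ≡ g i) → ⋁ f ≡ ⋁ g
  ⋁-cong f≡g = antisym (⋁-mono λ i → ≤-reflexive (f≡g i)) (⋁-mono λ i → ≤-reflexive (sym (f≡g i)))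

  ⊗-⋁-least : ∀ {I : Set} {x z : Ω} (f : I → Ω) → (∀ i → x ⊗ f i ≤ z) → x ⊗ ⋁ f ≤ z
  ⊗-⋁-least {x = x} f h = ≤-trans (≤-reflexive (⊗-distribˡ-⋁ x f)) (⋁-least _ _ h)

  ⋁-⊗-least : ∀ {I : Set} {x z : Ω} (f : I → Ω) → (∀ i → f i ⊗ x ≤ z) → ⋁ f ⊗ x ≤ z
  ⋁-⊗-least {x = x} f h = ≤-trans (≤-reflexive (⊗-distribʳ-⋁ f x)) (⋁-least _ _ h)

  -- Monotonicity of ⊗ is not an axiom: it comes from distributivity over the
  -- join x ∨ y, which equals y when x ≤ y.
  ⊗-monoˡ : ∀ {x y z} → x ≤ y → x ⊗ z ≤ y ⊗ z
  ⊗-monoˡ {x} {y} {z} x≤y = begin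
    x ⊗ z                                 ≤⟨ ⋁-upper (λ t → (if t then x else y) ⊗ z) true ⟩
    ⋁ (λ t → (if t then x else y) ⊗ z)    ≡⟨ ⊗-distribʳ-⋁ _ z ⟨
    (x ∨ y) ⊗ z                           ≡⟨ cong (_⊗ z) (x≤y⇒x∨y≡y x≤y) ⟩
    y ⊗ z                                 ∎
    where open ≤-Reasoning

  ⊗-monoʳ : ∀ {x y z} → x ≤ y → z ⊗ x ≤ z ⊗ y
  ⊗-monoʳ {x} {y} {z} x≤y = begin
    z ⊗ x                                 ≤⟨ ⋁-upper (λ t → z ⊗ (if t then x else y)) true ⟩
    ⋁ (λ t → z ⊗ (if t then x else y))    ≡⟨ ⊗-distribˡ-⋁ z _ ⟨
    z ⊗ (x ∨ y)                           ≡⟨ cong (z ⊗_) (x≤y⇒x∨y≡y x≤y) ⟩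
    z ⊗ y                                 ∎
    where open ≤-Reasoning

module QRelations (Q : Quantale) (A : Set) where
  open Quantale Q
  open QuantaleProperties Q

  infix  4 _⊑_ _≋_
  infixr 6 _∨ʳ_
  infixr 7 _⨾_
  infixr 8 _^_
  infixl 9 _⁻ _*

  _⊑_ : QRel Q A → QRel Q A → Set
  _⊑_ = Defs._⊑_ Q

  _∨ʳ_ : QRel Q A → QRel Q A → QRel Q A
  _∨ʳ_ = Defs._∨ʳ_ Q

  _⨾_ : QRel Q A → QRel Q A → QRel Q A
  _⨾_ = Defs._⨾_ Q

  Δ : QRel Q A
  Δ = Defs.Δ Q

  _⁻ : QRel Q A → QRel Q A
  _⁻ = Defs._⁻ Q

  _^_ : QRel Q A → ℕ → QRel Q A
  _^_ = Defs._^_ Q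

  _* : QRel Q A → QRel Q A
  _* = Defs._* Q

  Commutes : QRel Q A → QRel Q A → Set
  Commutes = Defs.Commutes Q

  Diamond : QRel Q A → Set
  Diamond = Defs.Diamond Q

  Confluent : QRel Q A → Set
  Confluent = Defs.Confluent Q

  _≋_ : QRel Q A → QRel Q A → Set
  X ≋ Y = ∀ a b → X a b ≡ Y a b

  private
    variable
      X X′ Y Y′ Z : QRel Q A

  ⊑-refl : X ⊑ X
  ⊑-refl a b = ≤-refl

  ⊑-trans : X ⊑ Y → Y ⊑ Z → X ⊑ Z
  ⊑-trans X⊑Y Y⊑Z a b = ≤-trans (X⊑Y a b) (Y⊑Z a b)

  ⊑-reflexive : X ≋ Y → X ⊑ Y
  ⊑-reflexive X≋Y a b = ≤-reflexive (X≋Y a b)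

  ⊑-antisym : X ⊑ Y → Y ⊑ X → X ≋ Y
  ⊑-antisym X⊑Y Y⊑X a b = antisym (X⊑Y a b) (Y⊑X a b)

  ≋-refl : X ≋ X
  ≋-refl a b = refl

  ≋-sym : X ≋ Y → Y ≋ X
  ≋-sym X≋Y a b = sym (X≋Y a b)

  ≋-trans : X ≋ Y → Y ≋ Z → X ≋ Z
  ≋-trans X≋Y Y≋Z a b = trans (X≋Y a b) (Y≋Z a b)

  ⊑-preorder : Preorder _ _ _
  ⊑-preorder = record
    { Carrier    = QRel Q A
    ; _≈_        = _≋_
    ; _≲_        = _⊑_
    ; isPreorder = record
      { isEquivalence = record
        { refl  = ≋-refl
        ; sym   = ≋-sym
        ; trans = ≋-trans
        }
      ; reflexive = ⊑-reflexive
      ; trans     = ⊑-trans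
      }
    }

  module ⊑-Reasoning = PreorderReasoning ⊑-preorder

  ∨ʳ-upperˡ : X ⊑ X ∨ʳ Y
  ∨ʳ-upperˡ a b = ⋁-upper _ true

  ∨ʳ-upperʳ : Y ⊑ X ∨ʳ Y
  ∨ʳ-upperʳ a b = ⋁-upper _ false

  ∨ʳ-least : X ⊑ Z → Y ⊑ Z → X ∨ʳ Y ⊑ Z
  ∨ʳ-least X⊑Z Y⊑Z a b = ⋁-least _ _ λ { true → X⊑Z a b ; false → Y⊑Z a b }

  ⁻-mono : X ⊑ Y → X ⁻ ⊑ Y ⁻
  ⁻-mono X⊑Y a b = X⊑Y b a

  ⨾-mono : X ⊑ X′ → Y ⊑ Y′ → X ⨾ Y ⊑ X′ ⨾ Y′
  ⨾-mono X⊑X′ Y⊑Y′ a c = ⋁-mono λ b → ≤-trans (⊗-monoˡ (X⊑X′ a b)) (⊗-monoʳ (Y⊑Y′ b c))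

  ⨾-cong : X ≋ X′ → Y ≋ Y′ → X ⨾ Y ≋ X′ ⨾ Y′
  ⨾-cong X≋X′ Y≋Y′ = ⊑-antisym (⨾-mono (⊑-reflexive X≋X′) (⊑-reflexive Y≋Y′))
                                (⨾-mono (⊑-reflexive (≋-sym X≋X′)) (⊑-reflexive (≋-sym Y≋Y′)))

  ⨾-assoc : (X ⨾ Y) ⨾ Z ≋ X ⨾ (Y ⨾ Z)
  ⨾-assoc {X} {Y} {Z} = ⊑-antisym left⊑right right⊑left
    where
    left⊑right : (X ⨾ Y) ⨾ Z ⊑ X ⨾ (Y ⨾ Z)
    left⊑right a d = ⋁-least _ _ λ c → ⋁-⊗-least _ λ b → ≤-trans (≤-reflexive (⊗-assoc _ _ _))
      (≤-trans (⊗-monoʳ (⋁-upper (λ c → Y b c ⊗ Z c d) c)) (⋁-upper (λ b → X a b ⊗ (Y ⨾ Z) b d) b))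

    right⊑left : X ⨾ (Y ⨾ Z) ⊑ (X ⨾ Y) ⨾ Z
    right⊑left a d = ⋁-least _ _ λ b → ⊗-⋁-least _ λ c → ≤-trans (≤-reflexive (sym (⊗-assoc _ _ _)))
      (≤-trans (⊗-monoˡ (⋁-upper (λ b → X a b ⊗ Y b c) b)) (⋁-upper (λ c → (X ⨾ Y) a c ⊗ Z c d) c))

  ⨾-identityˡ : Δ ⨾ X ≋ X
  ⨾-identityˡ {X} = ⊑-antisym
    (λ a c → ⋁-least _ _ λ b → ⋁-⊗-least _ λ { refl → ≤-reflexive (⊗-identityˡ _) })
    (λ a c → ≤-trans (≤-reflexive (sym (⊗-identityˡ _)))
      (≤-trans (⊗-monoˡ (⋁-upper {a ≡ a} _ refl)) (⋁-upper (λ b → Δ a b ⊗ X b c) a)))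

  ⨾-identityʳ : X ⨾ Δ ≋ X
  ⨾-identityʳ {X} = ⊑-antisym
    (λ a c → ⋁-least _ _ λ b → ⊗-⋁-least _ λ { refl → ≤-reflexive (⊗-identityʳ _) })
    (λ a c → ≤-trans (≤-reflexive (sym (⊗-identityʳ _)))
      (≤-trans (⊗-monoʳ (⋁-upper {c ≡ c} _ refl)) (⋁-upper (λ b → X a b ⊗ Δ b c) c)))

  ^⊑* : ∀ n → X ^ n ⊑ X *
  ^⊑* {X} n a b = ⋁-upper (λ m → (X ^ m) a b) n

  Δ⊑* : Δ ⊑ X *
  Δ⊑* = ^⊑* 0

  ⊑* : X ⊑ X *
  ⊑* = ⊑-trans (⊑-reflexive (≋-sym ⨾-identityʳ)) (^⊑* 1)

  *-least : Δ ⊑ Y → X ⨾ Y ⊑ Y → X * ⊑ Y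
  *-least {Y} {X} Δ⊑Y X⨾Y⊑Y a b = ⋁-least _ _ λ n → ^⊑Y n a b
    where
    ^⊑Y : ∀ n → X ^ n ⊑ Y
    ^⊑Y zero    = Δ⊑Y
    ^⊑Y (suc n) = ⊑-trans (⨾-mono ⊑-refl (^⊑Y n)) X⨾Y⊑Y

  ⨾*-least : (∀ n → Y ⨾ X ^ n ⊑ Z) → Y ⨾ X * ⊑ Z
  ⨾*-least {Y} {X} h a c = ⋁-least _ _ λ b → ⊗-⋁-least _ λ n →
    ≤-trans (⋁-upper (λ b → Y a b ⊗ (X ^ n) b c) b) (h n a c)

  *⨾-least : (∀ n → X ^ n ⨾ Y ⊑ Z) → X * ⨾ Y ⊑ Z
  *⨾-least {X} {Y} h a c = ⋁-least _ _ λ b → ⋁-⊗-least _ λ n →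
    ≤-trans (⋁-upper (λ b → (X ^ n) a b ⊗ Y b c) b) (h n a c)

  ⨾*⊑* : X ⨾ X * ⊑ X *
  ⨾*⊑* = ⨾*-least λ n → ^⊑* (suc n)

  *⨾*⊑* : X * ⨾ X * ⊑ X *
  *⨾*⊑* {X} = *⨾-least ^⨾*⊑*
    where
    open ⊑-Reasoning
    ^⨾*⊑* : ∀ n → X ^ n ⨾ X * ⊑ X *
    ^⨾*⊑* zero    = ⊑-reflexive ⨾-identityˡ
    ^⨾*⊑* (suc n) = begin
      (X ⨾ X ^ n) ⨾ X *  ≈⟨ ⨾-assoc ⟩
      X ⨾ X ^ n ⨾ X *    ≲⟨ ⨾-mono ⊑-refl (^⨾*⊑* n) ⟩
      X ⨾ X *            ≲⟨ ⨾*⊑* ⟩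
      X *                ∎

  ⊑*⇒*⊑* : X ⊑ Y * → X * ⊑ Y *
  ⊑*⇒*⊑* X⊑Y* = *-least Δ⊑* (⊑-trans (⨾-mono X⊑Y* ⊑-refl) *⨾*⊑*)

  *-∨ʳ : (X ∨ʳ Y) * ≋ (X * ⨾ Y *) *
  *-∨ʳ {X} {Y} = ⊑-antisym (⊑*⇒*⊑* (⊑-trans X∨Y⊑X*⨾Y* ⊑*)) (⊑*⇒*⊑* X*⨾Y*⊑[X∨Y]*)
    where
    X∨Y⊑X*⨾Y* : X ∨ʳ Y ⊑ X * ⨾ Y *
    X∨Y⊑X*⨾Y* = ∨ʳ-least
      (⊑-trans ⊑* (⊑-trans (⊑-reflexive (≋-sym ⨾-identityʳ)) (⨾-mono ⊑-refl Δ⊑*)))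
      (⊑-trans ⊑* (⊑-trans (⊑-reflexive (≋-sym ⨾-identityˡ)) (⨾-mono Δ⊑* ⊑-refl)))

    X*⨾Y*⊑[X∨Y]* : X * ⨾ Y * ⊑ (X ∨ʳ Y) *
    X*⨾Y*⊑[X∨Y]* = ⊑-trans (⨾-mono (⊑*⇒*⊑* (⊑-trans ∨ʳ-upperˡ ⊑*)) (⊑*⇒*⊑* (⊑-trans ∨ʳ-upperʳ ⊑*)))
                           *⨾*⊑*

  commutes-^ : Commutes X Y → ∀ n → X ⁻ ⨾ Y ^ n ⊑ Y ^ n ⨾ X ⁻
  commutes-^ {X} X↓Y zero = ⊑-reflexive (≋-trans (⨾-identityʳ {X ⁻}) (≋-sym (⨾-identityˡ {X ⁻})))
  commutes-^ {X} {Y} X↓Y (suc n) = begin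
    X ⁻ ⨾ Y ⨾ Y ^ n      ≈⟨ ⨾-assoc ⟨
    (X ⁻ ⨾ Y) ⨾ Y ^ n    ≲⟨ ⨾-mono X↓Y ⊑-refl ⟩
    (Y ⨾ X ⁻) ⨾ Y ^ n    ≈⟨ ⨾-assoc ⟩
    Y ⨾ X ⁻ ⨾ Y ^ n      ≲⟨ ⨾-mono ⊑-refl (commutes-^ X↓Y n) ⟩
    Y ⨾ Y ^ n ⨾ X ⁻      ≈⟨ ⨾-assoc ⟨
    (Y ⨾ Y ^ n) ⨾ X ⁻    ∎
    where open ⊑-Reasoning

  commutes-*ʳ : Commutes X Y → Commutes X (Y *)
  commutes-*ʳ X↓Y = ⨾*-least λ n → ⊑-trans (commutes-^ X↓Y n) (⨾-mono (^⊑* n) ⊑-refl)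

  diamond-resp-≋ : X ≋ Y → Diamond X → Diamond Y
  diamond-resp-≋ {X} {Y} X≋Y ◇X = begin
    Y ⁻ ⨾ Y    ≈⟨ ⨾-cong (λ a b → X≋Y b a) X≋Y ⟨
    X ⁻ ⨾ X    ≲⟨ ◇X ⟩
    X ⨾ X ⁻    ≈⟨ ⨾-cong X≋Y (λ a b → X≋Y b a) ⟩
    Y ⨾ Y ⁻    ∎
    where open ⊑-Reasoning

  module Commutative (⊗-comm : ∀ x y → x ⊗ y ≡ y ⊗ x) where

    ⁻-⨾ : (X ⨾ Y) ⁻ ≋ Y ⁻ ⨾ X ⁻
    ⁻-⨾ c a = ⋁-cong λ b → ⊗-comm _ _

    commutes-sym : Commutes X Y → Commutes Y X
    commutes-sym {X} {Y} X↓Y = begin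
      Y ⁻ ⨾ X        ≈⟨ ⁻-⨾ ⟨
      (X ⁻ ⨾ Y) ⁻    ≲⟨ ⁻-mono X↓Y ⟩
      (Y ⨾ X ⁻) ⁻    ≈⟨ ⁻-⨾ ⟩
      X ⨾ Y ⁻        ∎
      where open ⊑-Reasoning

    commutes-*ˡ : Commutes X Y → Commutes (X *) Y
    commutes-*ˡ X↓Y = commutes-sym (commutes-*ʳ (commutes-sym X↓Y))

    diamond⇒confluent : Diamond X → Confluent X
    diamond⇒confluent ◇X = commutes-*ʳ (commutes-*ˡ ◇X)

    diamond-⨾ : Commutes X Y → Diamond X → Diamond Y → Diamond (X ⨾ Y)
    diamond-⨾ {X} {Y} X↓Y ◇X ◇Y = begin
      (X ⨾ Y) ⁻ ⨾ X ⨾ Y          ≈⟨ ⨾-cong ⁻-⨾ ≋-refl ⟩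
      (Y ⁻ ⨾ X ⁻) ⨾ X ⨾ Y        ≈⟨ reassoc ⟩
      Y ⁻ ⨾ (X ⁻ ⨾ X) ⨾ Y        ≲⟨ ⨾-mono ⊑-refl (⨾-mono ◇X ⊑-refl) ⟩
      Y ⁻ ⨾ (X ⨾ X ⁻) ⨾ Y        ≈⟨ ⨾-cong ≋-refl ⨾-assoc ⟩
      Y ⁻ ⨾ X ⨾ X ⁻ ⨾ Y          ≲⟨ ⨾-mono ⊑-refl (⨾-mono ⊑-refl X↓Y) ⟩
      Y ⁻ ⨾ X ⨾ Y ⨾ X ⁻          ≈⟨ ⨾-assoc ⟨
      (Y ⁻ ⨾ X) ⨾ Y ⨾ X ⁻        ≲⟨ ⨾-mono (commutes-sym X↓Y) ⊑-refl ⟩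
      (X ⨾ Y ⁻) ⨾ Y ⨾ X ⁻        ≈⟨ reassoc ⟩
      X ⨾ (Y ⁻ ⨾ Y) ⨾ X ⁻        ≲⟨ ⨾-mono ⊑-refl (⨾-mono ◇Y ⊑-refl) ⟩
      X ⨾ (Y ⨾ Y ⁻) ⨾ X ⁻        ≈⟨ reassoc ⟨
      (X ⨾ Y) ⨾ Y ⁻ ⨾ X ⁻        ≈⟨ ⨾-cong ≋-refl ⁻-⨾ ⟨
      (X ⨾ Y) ⨾ (X ⨾ Y) ⁻        ∎
      where
      open ⊑-Reasoning
      reassoc : ∀ {T U V W} → (T ⨾ U) ⨾ V ⨾ W ≋ T ⨾ (U ⨾ V) ⨾ W
      reassoc {T} {U} {V} {W} = ≋-trans (⨾-assoc {T} {U} {V ⨾ W}) (≋-sym (⨾-cong (≋-refl {T}) (⨾-assoc {U} {V} {W})))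

open Defs using (Commutes; Confluent; _*; _∨ʳ_)

mainTheorem3 : (Q : LawverianQuantale) (A : Set) (R S : QRel (LawverianQuantale.quantale Q) A)
    → Commutes (LawverianQuantale.quantale Q) (_* (LawverianQuantale.quantale Q) R) (_* (LawverianQuantale.quantale Q) S)
    → Confluent (LawverianQuantale.quantale Q) R
    → Confluent (LawverianQuantale.quantale Q) S
    → Confluent (LawverianQuantale.quantale Q) (_∨ʳ_ (LawverianQuantale.quantale Q) R S)
mainTheorem3 Q A R S R*↓S* ◇R* ◇S* =
  diamond-resp-≋ (≋-sym *-∨ʳ) (diamond⇒confluent (diamond-⨾ R*↓S* ◇R* ◇S*))
  where
  open LawverianQuantale Q using (quantale; ⊗-comm)
  open QRelations quantale A
  open Commutative ⊗-comm
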